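{- Let $\Gamma$ be a sub-semigroup of a group $G$ with identity $e$, and $\Sigma$ a finite generating set of $\Gamma$. Define the (possibly infinite) automaton $\mathcal{A}$ with alphabet $\Sigma \times (\Sigma \cup \{e\})$, set of states $Q = \Gamma^{ -1}(\Gamma \cup \{e\}) = \{g^{ -1}h : g \in \Gamma, h \in \Gamma \cup\{e\}\} \subseteq G$, unique initial state $e$, unique final state $e$, and a transition $p \xrightarrow{(g,h)} q$ if and only if $q = g^{ -1} p h$. Then the trim of $\mathcal{A}$ is the relation automaton of $\Gamma$, i.e. it is the minimal deterministic automaton recognizing $L^{rel} = \{(u_1,v_1)\cdots(u_n,v_n) \in (\Sigma \times (\Sigma\cup\{e\}))^* : u_1\cdots u_n = v_1\cdots v_n \text{ in } G\}$.
   Context: An automaton is a tuple (alphabet, set of states, set of labelled transitions, initial states, final states); it recognizes a word $a_1\cdots a_n$ if there is a path labelled $a_1,\dots,a_n$ from an initial to a final state. It is deterministic if it has one initial state and at most one transition from each state with each label. The trim of an automaton is its restriction to the states lying on some path from an initial state to a final state. The minimal automaton of a language is a deterministic automaton recognizing it with the minimal number of states. A letter $e$ is evaluated as the identity of $G$. -}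

module Defs where

open import Level using (Level; _⊔_; suc)
open import Data.Nat using (ℕ)
open import Data.Fin using (Fin)
open import Data.Maybe using (Maybe; just; nothing)
open import Data.List using (List; []; _∷_; map)
open import Data.List.NonEmpty using (List⁺; toList)
open import Data.Product using (Σ; ∃; ∃-syntax; _×_; _,_; proj₁; proj₂)
open import Data.Sum using (_⊎_)
open import Relation.Binary.PropositionalEquality using (_≡_)
open import Relation.Binary.Bundles using (Setoid)
import Relation.Binary.Construct.On as On
open import Function.Bundles using (Surjection; _⇔_)
open import Algebra.Bundles using (Group)

-- States form a setoid (so that states may be group elements
-- compared up to the group's equality); the "set of states" is the
-- quotient.

record Automaton (a s r t : Level) (Letter : Set a) : Set (a ⊔ suc (s ⊔ r ⊔ t)) where
  field
    StateS : Setoid s r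
  open Setoid StateS public renaming (Carrier to State; _≈_ to _≈ₛ_)
  field
    Trans : State → Letter → State → Set t
    Init  : State → Set t
    Final : State → Set t

module _ {a s r t : Level} {Letter : Set a} (M : Automaton a s r t Letter) where
  open Automaton M

  data Path : State → List Letter → State → Set (a ⊔ s ⊔ t) where
    [] : ∀ {p} → Path p [] p
    _∷_ : ∀ {p x q w f} → Trans p x q → Path q w f → Path p (x ∷ w) f

  Accepts : List Letter → Set (a ⊔ s ⊔ t)
  Accepts w = ∃[ i ] ∃[ f ] (Init i × Final f × Path i w f)

  -- relations are compatible with equality of states (needed for the
  -- quotient to be a genuine automaton)
  record Respecting : Set (a ⊔ s ⊔ r ⊔ t) where
    field
      trans-resp : ∀ {p p' x q q'} → p ≈ₛ p' → q ≈ₛ q' → Trans p x q → Trans p' x q'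
      init-resp  : ∀ {p p'} → p ≈ₛ p' → Init p → Init p'
      final-resp : ∀ {p p'} → p ≈ₛ p' → Final p → Final p'

  record Deterministic : Set (a ⊔ s ⊔ r ⊔ t) where
    field
      initial     : State
      initial-ok  : Init initial
      initial-uniq : ∀ {p} → Init p → p ≈ₛ initial
      trans-uniq  : ∀ {p p' x q q'} → p ≈ₛ p' → Trans p x q → Trans p' x q' → q ≈ₛ q'

  OnSuccessfulPath : State → Set (a ⊔ s ⊔ t)
  OnSuccessfulPath q = ∃[ i ] ∃[ u ] ∃[ v ] ∃[ f ]
    (Init i × Path i u q × Path q v f × Final f)

  Trim : Automaton a (a ⊔ s ⊔ t) r t Letter
  Trim = record
    { StateS = On.setoid {B = Σ State OnSuccessfulPath} StateS proj₁
    ; Trans  = λ p x q → Trans (proj₁ p) x (proj₁ q)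
    ; Init   = λ p → Init (proj₁ p)
    ; Final  = λ p → Final (proj₁ p)
    }

Recognizes : ∀ {a s r t ℓ} {Letter : Set a} → Automaton a s r t Letter →
             (List Letter → Set ℓ) → Set (a ⊔ s ⊔ t ⊔ ℓ)
Recognizes M L = ∀ w → L w ⇔ Accepts M w

-- M is a minimal deterministic automaton for L: it is a (well-formed)
-- deterministic automaton recognizing L, and its set of states has
-- cardinality at most that of any deterministic automaton B recognizing L
-- (at universe levels s' r' t'): the states of M are the image of a
-- subset of the states of B (namely those of the trim of B) under a
-- well-defined map.  (A surjection rather than an injection is used for
-- the cardinality comparison, as injections out of a quotient cannot be
-- built constructively without choosing representatives.)
record IsMinimalDFA {a s r t ℓ} (s' r' t' : Level) {Letter : Set a}
    (M : Automaton a s r t Letter) (L : List Letter → Set ℓ)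
    : Set (a ⊔ s ⊔ r ⊔ t ⊔ ℓ ⊔ suc (s' ⊔ r' ⊔ t')) where
  field
    respecting    : Respecting M
    deterministic : Deterministic M
    recognizes    : Recognizes M L
    minimal       : (B : Automaton a s' r' t' Letter) → Respecting B →
                    Deterministic B → Recognizes B L →
                    Surjection (Automaton.StateS (Trim B)) (Automaton.StateS M)

module _ {c ℓ : Level} (G : Group c ℓ) where
  open Group G

  prod : List Carrier → Carrier
  prod []       = ε
  prod (x ∷ xs) = x ∙ prod xs

  record IsSubSemigroup {p} (Γ : Carrier → Set p) : Set (c ⊔ ℓ ⊔ p) where
    field
      resp    : ∀ {x y} → x ≈ y → Γ x → Γ y
      ∙-closed : ∀ {x y} → Γ x → Γ y → Γ (x ∙ y)

  record IsFiniteGeneratingSet {p} (Γ : Carrier → Set p) (n : ℕ) (σ : Fin n → Carrier)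
      : Set (c ⊔ ℓ ⊔ p) where
    field
      injective : ∀ i j → σ i ≈ σ j → i ≡ j
      ⊆Γ        : ∀ i → Γ (σ i)
      generates : ∀ {γ} → Γ γ → ∃[ w ] (γ ≈ prod (map σ (toList w)))

  module _ {p} (Γ : Carrier → Set p) (n : ℕ) (σ : Fin n → Carrier) where

    -- alphabet Σ × (Σ ∪ {e}); `nothing` is the letter e
    Letter : Set
    Letter = Fin n × Maybe (Fin n)

    evalʳ : Maybe (Fin n) → Carrier
    evalʳ (just j) = σ j
    evalʳ nothing  = ε

    Lrel : List Letter → Set ℓ
    Lrel w = prod (map (λ x → σ (proj₁ x)) w) ≈ prod (map (λ x → evalʳ (proj₂ x)) w)

    InQ : Carrier → Set (c ⊔ ℓ ⊔ p)
    InQ x = ∃[ g ] ∃[ h ] (Γ g × (Γ h ⊎ h ≈ ε) × x ≈ g ⁻¹ ∙ h)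

    𝒜 : Automaton Level.zero (c ⊔ ℓ ⊔ p) ℓ ℓ Letter
    𝒜 = record
      { StateS = On.setoid {B = Σ Carrier InQ} setoid proj₁
      ; Trans  = λ p x q → proj₁ q ≈ (σ (proj₁ x) ⁻¹ ∙ proj₁ p) ∙ evalʳ (proj₂ x)
      ; Init   = λ p → proj₁ p ≈ ε
      ; Final  = λ p → proj₁ p ≈ ε
      }

-- Reading a word w from the state e of 𝒜 always leads to after w = (upper w)⁻¹ (lower w), where
-- upper w and lower w are the products of the two tracks.  This lies in Q since upper w ∈ Γ and
-- lower w ∈ Γ ∪ {e} (for empty w, e = γ⁻¹γ for some γ ∈ Γ), and it equals e exactly when w ∈ L^rel;
-- so the trim recognizes L^rel, and it is deterministic because a transition is a multiplication.
-- For minimality, a trim state b of any automaton B recognizing L^rel, lying on an accepting path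
-- labelled u·v, is sent to after u.  This is well defined because u·v ∈ L^rel forces
-- after u = (upper v)(lower v)⁻¹, which depends only on a word readable from b to a final state;
-- and it is onto because every trim state of 𝒜 is after u for some u·v ∈ L^rel.
module Submission where

open import Defs
open import Level using (Level; 0ℓ; _⊔_)
open import Data.Nat using (ℕ)
open import Data.Fin using (Fin)
open import Data.Maybe using (Maybe; just; nothing)
open import Data.List using (List; []; _∷_; _++_; _∷ʳ_; [_]; map)
open import Data.List.Properties using (++-assoc; ++-identityʳ)
open import Data.Product using (∃; ∃-syntax; _×_; _,_; proj₁; proj₂; map₂)
open import Data.Sum using (_⊎_; inj₁; inj₂)
open import Function using (_∘_)
open import Function.Definitions using (Congruent)
open import Function.Bundles using (Surjection; Equivalence; mk⇔)
open import Algebra.Bundles using (Group)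
import Algebra.Properties.Group as GroupProperties
import Relation.Binary.PropositionalEquality as ≡
import Function.Consequences.Setoid as SetoidFunctionConsequences
import Relation.Binary.Reasoning.Setoid as SetoidReasoning

module _ {a s r t : Level} {A : Set a} {M : Automaton a s r t A} where
  open Automaton M

  Path-++ : ∀ {p u q v f} → Path M p u q → Path M q v f → Path M p (u ++ v) f
  Path-++ []      Q = Q
  Path-++ (T ∷ P) Q = T ∷ Path-++ P Q

  Path-split : ∀ {p f} u {v} → Path M p (u ++ v) f → ∃[ q ] (Path M p u q × Path M q v f)
  Path-split []      P       = _ , [] , P
  Path-split (_ ∷ u) (T ∷ P) with Path-split u P
  ... | q , P₁ , P₂ = q , T ∷ P₁ , P₂

  Path-resp : Respecting M → ∀ {p p′ w f} → p ≈ₛ p′ → Path M p w f →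
              ∃[ f′ ] (f ≈ₛ f′ × Path M p′ w f′)
  Path-resp _    p≈p′ []      = _ , p≈p′ , []
  Path-resp resp p≈p′ (T ∷ P) = _ , refl , Respecting.trans-resp resp p≈p′ refl T ∷ P

module _ {a s r t : Level} {A : Set a} (M : Automaton a s r t A) where
  open Automaton M

  Path-Trim⁻ : ∀ {p w q} → Path (Trim M) p w q → Path M (proj₁ p) w (proj₁ q)
  Path-Trim⁻ []      = []
  Path-Trim⁻ (T ∷ P) = T ∷ Path-Trim⁻ P

  Path-Trim⁺ : ∀ {i u p v f} (I : Init i) (P : Path M i u p) (Q : Path M p v f) (F : Final f) →
               ∃ λ f∈Trim → Path (Trim M) (p , i , u , v , f , I , P , Q , F) v (f , f∈Trim)
  Path-Trim⁺ I P []      F = _ , []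
  Path-Trim⁺ I P (T ∷ Q) F = map₂ (T ∷_) (Path-Trim⁺ I (Path-++ P (T ∷ [])) Q F)

  Accepts-Trim⁺ : ∀ {w} → Accepts M w → Accepts (Trim M) w
  Accepts-Trim⁺ (_ , _ , I , F , P) = _ , _ , I , F , proj₂ (Path-Trim⁺ I [] P F)

  Accepts-Trim⁻ : ∀ {w} → Accepts (Trim M) w → Accepts M w
  Accepts-Trim⁻ (_ , _ , I , F , P) = _ , _ , I , F , Path-Trim⁻ P

  Recognizes-Trim : ∀ {ℓ} {L : List A → Set ℓ} → Recognizes M L → Recognizes (Trim M) L
  Recognizes-Trim rec w = mk⇔ (Accepts-Trim⁺ ∘ Equivalence.to (rec w))
                              (Equivalence.from (rec w) ∘ Accepts-Trim⁻)

  Trim-respecting : Respecting M → Respecting (Trim M)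
  Trim-respecting resp = record
    { trans-resp = trans-resp
    ; init-resp  = init-resp
    ; final-resp = final-resp
    }
    where open Respecting resp

  Trim-deterministic : Deterministic M → ∀ {w} → Accepts M w → Deterministic (Trim M)
  Trim-deterministic det (i , f , I , F , P) = record
    { initial      = i , i , [] , _ , f , I , [] , P , F
    ; initial-ok   = I
    ; initial-uniq = λ I′ → trans (initial-uniq I′) (sym (initial-uniq I))
    ; trans-uniq   = trans-uniq
    }
    where open Deterministic det

module _ {c ℓ : Level} (G : Group c ℓ) where
  open Group G

  prod-map-++ : ∀ {a} {A : Set a} (f : A → Carrier) u v →
                prod G (map f (u ++ v)) ≈ prod G (map f u) ∙ prod G (map f v)
  prod-map-++ f []      v = sym (identityˡ _)
  prod-map-++ f (x ∷ u) v = trans (∙-congˡ (prod-map-++ f u v)) (sym (assoc _ _ _))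

  prod-map-∷ʳ : ∀ {a} {A : Set a} (f : A → Carrier) u x →
                prod G (map f (u ∷ʳ x)) ≈ prod G (map f u) ∙ f x
  prod-map-∷ʳ f u x = trans (prod-map-++ f u [ x ]) (∙-congˡ (identityʳ (f x)))

module RelationAutomaton {c ℓ p : Level} (G : Group c ℓ) (Γ : Group.Carrier G → Set p)
    (n : ℕ) (σ : Fin n → Group.Carrier G)
    (Γ-semigroup : IsSubSemigroup G Γ) (Γ-nonempty : ∃[ γ ] Γ γ) (σ∈Γ : ∀ i → Γ (σ i)) where
  open Group G
  open GroupProperties G using (\\-leftDividesˡ; y≈x\\z; ∙-cancelˡ; ∙-cancelʳ; ⁻¹-anti-homo-∙)
  open IsSubSemigroup Γ-semigroup
  open SetoidReasoning setoid

  Word : Set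
  Word = List (Letter G Γ n σ)

  𝔄 : Automaton 0ℓ (c ⊔ ℓ ⊔ p) ℓ ℓ (Letter G Γ n σ)
  𝔄 = 𝒜 G Γ n σ

  L : Word → Set ℓ
  L = Lrel G Γ n σ

  ⟦_⟧ : Maybe (Fin n) → Carrier
  ⟦_⟧ = evalʳ G Γ n σ

  upper lower : Word → Carrier
  upper w = prod G (map (σ ∘ proj₁) w)
  lower w = prod G (map (⟦_⟧ ∘ proj₂) w)

  Γ∪ε : Carrier → Set (ℓ ⊔ p)
  Γ∪ε x = Γ x ⊎ x ≈ ε

  Γ∪ε-∙-closed : ∀ {x y} → Γ∪ε x → Γ∪ε y → Γ∪ε (x ∙ y)
  Γ∪ε-∙-closed (inj₁ x∈Γ) (inj₁ y∈Γ) = inj₁ (∙-closed x∈Γ y∈Γ)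
  Γ∪ε-∙-closed (inj₁ x∈Γ) (inj₂ y≈ε) = inj₁ (resp (sym (trans (∙-congˡ y≈ε) (identityʳ _))) x∈Γ)
  Γ∪ε-∙-closed (inj₂ x≈ε) (inj₁ y∈Γ) = inj₁ (resp (sym (trans (∙-congʳ x≈ε) (identityˡ _))) y∈Γ)
  Γ∪ε-∙-closed (inj₂ x≈ε) (inj₂ y≈ε) = inj₂ (trans (∙-cong x≈ε y≈ε) (identityˡ ε))

  ⟦⟧∈Γ∪ε : ∀ y → Γ∪ε ⟦ y ⟧
  ⟦⟧∈Γ∪ε (just j) = inj₁ (σ∈Γ j)
  ⟦⟧∈Γ∪ε nothing  = inj₂ refl

  lower∈Γ∪ε : ∀ w → Γ∪ε (lower w)
  lower∈Γ∪ε []      = inj₂ refl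
  lower∈Γ∪ε (x ∷ w) = Γ∪ε-∙-closed (⟦⟧∈Γ∪ε (proj₂ x)) (lower∈Γ∪ε w)

  upper∈Γ : ∀ x w → Γ (upper (x ∷ w))
  upper∈Γ x []      = resp (sym (identityʳ _)) (σ∈Γ (proj₁ x))
  upper∈Γ x (y ∷ w) = ∙-closed (σ∈Γ (proj₁ x)) (upper∈Γ y w)

  after : Word → Carrier
  after u = upper u \\ lower u

  after∈Q : ∀ u → InQ G Γ n σ (after u)
  after∈Q []      = let (γ , γ∈Γ) = Γ-nonempty in
                    γ , γ , γ∈Γ , inj₁ γ∈Γ , trans (inverseˡ ε) (sym (inverseˡ γ))
  after∈Q (x ∷ w) = upper (x ∷ w) , lower (x ∷ w) , upper∈Γ x w , lower∈Γ∪ε (x ∷ w) , refl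

  stateAfter : Word → Automaton.State 𝔄
  stateAfter u = after u , after∈Q u

  Trans⁻ : ∀ p x q → Automaton.Trans 𝔄 p x q →
           σ (proj₁ x) ∙ proj₁ q ≈ proj₁ p ∙ ⟦ proj₂ x ⟧
  Trans⁻ (p , _) (i , y) (q , _) T = begin
    σ i ∙ q                    ≈⟨ ∙-congˡ T ⟩
    σ i ∙ ((σ i \\ p) ∙ ⟦ y ⟧) ≈⟨ assoc _ _ _ ⟨
    (σ i ∙ (σ i \\ p)) ∙ ⟦ y ⟧ ≈⟨ ∙-congʳ (\\-leftDividesˡ (σ i) p) ⟩
    p ∙ ⟦ y ⟧                  ∎

  Trans-stateAfter : ∀ u x → Automaton.Trans 𝔄 (stateAfter u) x (stateAfter (u ∷ʳ x))
  Trans-stateAfter u x@(i , y) = begin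
    upper (u ∷ʳ x) ⁻¹ ∙ lower (u ∷ʳ x)        ≈⟨ ∙-cong (⁻¹-cong (prod-map-∷ʳ G _ u x))
                                                            (prod-map-∷ʳ G _ u x) ⟩
    (upper u ∙ σ i) ⁻¹ ∙ (lower u ∙ ⟦ y ⟧)      ≈⟨ ∙-congʳ (⁻¹-anti-homo-∙ (upper u) (σ i)) ⟩
    (σ i ⁻¹ ∙ upper u ⁻¹) ∙ (lower u ∙ ⟦ y ⟧)   ≈⟨ assoc _ _ _ ⟩
    σ i ⁻¹ ∙ (upper u ⁻¹ ∙ (lower u ∙ ⟦ y ⟧))   ≈⟨ ∙-congˡ (assoc _ _ _) ⟨
    σ i ⁻¹ ∙ (after u ∙ ⟦ y ⟧)                 ≈⟨ assoc _ _ _ ⟨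
    (σ i ⁻¹ ∙ after u) ∙ ⟦ y ⟧                 ∎

  run : ∀ u w → Path 𝔄 (stateAfter u) w (stateAfter (u ++ w))
  run u []      rewrite ++-identityʳ u = []
  run u (x ∷ w) rewrite ≡.sym (++-assoc u [ x ] w) = Trans-stateAfter u x ∷ run (u ∷ʳ x) w

  Path-value : ∀ {p w q} → Path 𝔄 p w q → upper w ∙ proj₁ q ≈ proj₁ p ∙ lower w
  Path-value [] = trans (identityˡ _) (sym (identityʳ _))
  Path-value {p′@(p , _)} {x@(i , y) ∷ w} {q , _} (_∷_ {q = r} T P) = begin
    (σ i ∙ upper w) ∙ q           ≈⟨ assoc _ _ _ ⟩
    σ i ∙ (upper w ∙ q)           ≈⟨ ∙-congˡ (Path-value P) ⟩
    σ i ∙ (proj₁ r ∙ lower w)     ≈⟨ assoc _ _ _ ⟨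
    (σ i ∙ proj₁ r) ∙ lower w     ≈⟨ ∙-congʳ (Trans⁻ p′ x r T) ⟩
    (p ∙ ⟦ y ⟧) ∙ lower w         ≈⟨ assoc _ _ _ ⟩
    p ∙ lower (x ∷ w)             ∎

  reached≈after : ∀ {i u q} → Automaton.Init 𝔄 i → Path 𝔄 i u q → proj₁ q ≈ after u
  reached≈after {u = u} I P =
    y≈x\\z (upper u) _ _ (trans (Path-value P) (trans (∙-congʳ I) (identityˡ _)))

  Lrel⇒after≈ε : ∀ w → L w → after w ≈ ε
  Lrel⇒after≈ε w w∈L = trans (∙-congˡ (sym w∈L)) (inverseˡ (upper w))

  after≈ε⇒Lrel : ∀ w → after w ≈ ε → L w
  after≈ε⇒Lrel w after≈ε = begin
    upper w               ≈⟨ identityʳ _ ⟨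
    upper w ∙ ε           ≈⟨ ∙-congˡ after≈ε ⟨
    upper w ∙ after w     ≈⟨ \\-leftDividesˡ (upper w) (lower w) ⟩
    lower w               ∎

  𝔄-recognizes : Recognizes 𝔄 L
  𝔄-recognizes w = mk⇔
    (λ w∈L → stateAfter [] , stateAfter w , inverseˡ ε , Lrel⇒after≈ε w w∈L , run [] w)
    (λ (_ , _ , I , F , P) → after≈ε⇒Lrel w (trans (sym (reached≈after I P)) F))

  𝔄-respecting : Respecting 𝔄
  𝔄-respecting = record
    { trans-resp = λ p≈p′ q≈q′ T → trans (sym q≈q′) (trans T (∙-congʳ (∙-congˡ p≈p′)))
    ; init-resp  = λ p≈p′ I → trans (sym p≈p′) I
    ; final-resp = λ p≈p′ F → trans (sym p≈p′) F
    }

  𝔄-deterministic : Deterministic 𝔄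
  𝔄-deterministic = record
    { initial      = stateAfter []
    ; initial-ok   = inverseˡ ε
    ; initial-uniq = λ I → trans I (sym (inverseˡ ε))
    ; trans-uniq   = λ p≈p′ T T′ → trans T (trans (∙-congʳ (∙-congˡ p≈p′)) (sym T′))
    }

  after-residual : ∀ u {v} → L (u ++ v) → after u ∙ lower v ≈ upper v
  after-residual u {v} uv∈L = ∙-cancelˡ (upper u) _ _ (begin
    upper u ∙ (after u ∙ lower v)   ≈⟨ assoc _ _ _ ⟨
    (upper u ∙ after u) ∙ lower v   ≈⟨ ∙-congʳ (\\-leftDividesˡ (upper u) (lower u)) ⟩
    lower u ∙ lower v               ≈⟨ prod-map-++ G _ u v ⟨
    lower (u ++ v)                  ≈⟨ uv∈L ⟨
    upper (u ++ v)                  ≈⟨ prod-map-++ G _ u v ⟩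
    upper u ∙ upper v               ∎)

  shared-suffix⇒after≈ : ∀ u u′ {v} → L (u ++ v) → L (u′ ++ v) → after u ≈ after u′
  shared-suffix⇒after≈ u u′ {v} uv∈L u′v∈L =
    ∙-cancelʳ (lower v) _ _ (trans (after-residual u uv∈L) (sym (after-residual u′ u′v∈L)))

  trimState : ∀ u v → L (u ++ v) → Automaton.State (Trim 𝔄)
  trimState u v uv∈L =
    stateAfter u , stateAfter [] , u , v , stateAfter (u ++ v) ,
    inverseˡ ε , run [] u , run u v , Lrel⇒after≈ε (u ++ v) uv∈L

  module _ {s′ r′ t′ : Level} (B : Automaton 0ℓ s′ r′ t′ (Letter G Γ n σ))
           (B-respecting : Respecting B) (B-recognizes : Recognizes B L) where
    open Automaton (Trim B) using () renaming (StateS to TrimB; _≈ₛ_ to _≈B_)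
    open Automaton (Trim 𝔄) using () renaming (StateS to Trim𝔄; _≈ₛ_ to _≈𝔄_)

    B-accepted : ∀ {i w f} → Automaton.Init B i → Path B i w f → Automaton.Final B f → L w
    B-accepted I P F = Equivalence.from (B-recognizes _) (_ , _ , I , F , P)

    residualClass : Automaton.State (Trim B) → Automaton.State (Trim 𝔄)
    residualClass (_ , _ , u , v , _ , I , Pᵤ , Pᵥ , F) =
      trimState u v (B-accepted I (Path-++ Pᵤ Pᵥ) F)

    residualClass-cong : Congruent _≈B_ _≈𝔄_ residualClass
    residualClass-cong {_ , _ , u , v , _ , I , Pᵤ , Pᵥ , F} {_ , _ , u′ , _ , _ , I′ , Pᵤ′ , _} b≈b′
      with Path-resp B-respecting b≈b′ Pᵥ
    ... | _ , f≈f′ , Pᵥ′ =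
      shared-suffix⇒after≈ u u′
        (B-accepted I (Path-++ Pᵤ Pᵥ) F)
        (B-accepted I′ (Path-++ Pᵤ′ Pᵥ′) (Respecting.final-resp B-respecting f≈f′ F))

    residualClass-strictlySurjective : ∀ q → ∃[ b ] (residualClass b ≈𝔄 q)
    residualClass-strictlySurjective (_ , _ , u , v , _ , I , Pᵤ , Pᵥ , F)
      with Equivalence.to (B-recognizes (u ++ v))
             (Equivalence.from (𝔄-recognizes (u ++ v)) (_ , _ , I , F , Path-++ Pᵤ Pᵥ))
    ... | _ , _ , I′ , F′ , P′ with Path-split u P′
    ... | b , P′ᵤ , P′ᵥ = (b , _ , u , v , _ , I′ , P′ᵤ , P′ᵥ , F′) , sym (reached≈after I Pᵤ)

    Trim-surjection : Surjection TrimB Trim𝔄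
    Trim-surjection = record
      { to         = residualClass
      ; cong       = λ {b} {b′} → residualClass-cong {b} {b′}
      ; surjective = strictlySurjective⇒surjective {f = residualClass}
                       (λ {b} {b′} → residualClass-cong {b} {b′}) residualClass-strictlySurjective
      }
      where open SetoidFunctionConsequences TrimB Trim𝔄 using (strictlySurjective⇒surjective)

mainTheorem3 : ∀ {c ℓ p : Level} (G : Group c ℓ) (Γ : Group.Carrier G → Set p)
    (n : ℕ) (σ : Fin n → Group.Carrier G) →
    IsSubSemigroup G Γ → (∃[ γ ] Γ γ) → IsFiniteGeneratingSet G Γ n σ →
    ∀ {s' r' t' : Level} →
    IsMinimalDFA s' r' t' (Trim (𝒜 G Γ n σ)) (Lrel G Γ n σ)
mainTheorem3 G Γ n σ Γ-semigroup Γ-nonempty Σ-generates = record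
  { respecting    = Trim-respecting 𝔄 𝔄-respecting
  ; deterministic = Trim-deterministic 𝔄 𝔄-deterministic
                      (Equivalence.to (𝔄-recognizes []) (Group.refl G))
  ; recognizes    = Recognizes-Trim 𝔄 𝔄-recognizes
  ; minimal       = λ B B-respecting _ B-recognizes → Trim-surjection B B-respecting B-recognizes
  }
  where open RelationAutomaton G Γ n σ Γ-semigroup Γ-nonempty (IsFiniteGeneratingSet.⊆Γ Σ-generates)
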